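{- Let $n,k_1,k_2\ge 0$ with $\ell=n-k_1-k_2\ge 0$. If $G\in\mathcal{S}$, then there is a matrix $G'\in\mathcal{T}$ such that the $\mathbb{Z}_4$-codes generated by (the rows of) $G$ and $G'$ are equivalent.
   Context: $\mathbb{Z}_4=\{0,1,2,3\}$ is the ring of integers modulo $4$; a $\mathbb{Z}_4$-code of length $n$ is a submodule of $\mathbb{Z}_4^n$, and the code generated by a matrix is the $\mathbb{Z}_4$-span of its rows. Two codes are equivalent if $C'=CP$ for a monomial matrix $P$ with nonzero entries in $\{1,-1\}$. Order $\mathbb{Z}_4$ by $0<1<2<3$ and order $\mathbb{Z}_4^m$ lexicographically ($a\le b$ iff $a=b$ or $a_k<b_k$ at the first index $k$ where they differ). $M_{m\times n}(R)$ is the set of $m\times n$ matrices with entries in $R$. For $T\subseteq M_{m\times n}(\mathbb{Z}_4)$, $P_{row}(T)$ is the set of matrices in $T$ whose rows $a_1,\dots,a_m$ satisfy $a_i\le a_j$ whenever $i\le j$. For a $k_1\times k_2$ $(0,1)$-matrix $A$, a $k_1\times \ell$ $\mathbb{Z}_4$-matrix $B$ and a $k_2\times\ell$ $(0,1)$-matrix $D$, let $G(A,B,D)=\begin{pmatrix} I_{k_1}&A&B\\ O&2I_{k_2}&2D\end{pmatrix}$. Let $\mathcal{S}=\{G(A,B,D)\mid A\in M_{k_1\times k_2}(\{0,1\}),B\in M_{k_1\times\ell}(\mathbb{Z}_4),D\in M_{k_2\times\ell}(\{0,1\})\}$ and $\mathcal{T}=\{G(A,B,D)\in\mathcal{S}\mid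 A\in P_{row}(M_{k_1\times k_2}(\{0,1\}))\}$. -}

module Defs where

open import Data.Nat using (ℕ; zero; suc; _+_)
import Data.Nat as ℕ
open import Data.Fin using (Fin; zero; suc; splitAt; toℕ)
import Data.Fin as F
open import Data.Bool using (Bool; true; false)
open import Data.Sum using (_⊎_; inj₁; inj₂)
open import Data.Product using (Σ; ∃; _×_; _,_)
open import Relation.Binary.PropositionalEquality using (_≡_; _≢_)
open import Relation.Nullary using (¬_)

data ℤ₄ : Set where
  z0 z1 z2 z3 : ℤ₄

infixl 6 _⊕_
infixl 7 _⊗_

_⊕_ : ℤ₄ → ℤ₄ → ℤ₄
z0 ⊕ y = y
z1 ⊕ z0 = z1
z1 ⊕ z1 = z2
z1 ⊕ z2 = z3
z1 ⊕ z3 = z0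
z2 ⊕ z0 = z2
z2 ⊕ z1 = z3
z2 ⊕ z2 = z0
z2 ⊕ z3 = z1
z3 ⊕ z0 = z3
z3 ⊕ z1 = z0
z3 ⊕ z2 = z1
z3 ⊕ z3 = z2

_⊗_ : ℤ₄ → ℤ₄ → ℤ₄
z0 ⊗ y = z0
z1 ⊗ y = y
z2 ⊗ y = y ⊕ y
z3 ⊗ y = y ⊕ y ⊕ y

toℕ₄ : ℤ₄ → ℕ
toℕ₄ z0 = 0
toℕ₄ z1 = 1
toℕ₄ z2 = 2
toℕ₄ z3 = 3

_<₄_ : ℤ₄ → ℤ₄ → Set
x <₄ y = toℕ₄ x ℕ.< toℕ₄ y

bit : Bool → ℤ₄
bit false = z0
bit true  = z1

Vec₄ : ℕ → Set
Vec₄ n = Fin n → ℤ₄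

Mat₄ : ℕ → ℕ → Set
Mat₄ m n = Fin m → Fin n → ℤ₄

sum₄ : ∀ {n} → (Fin n → ℤ₄) → ℤ₄
sum₄ {zero}  f = z0
sum₄ {suc n} f = f zero ⊕ sum₄ (λ i → f (suc i))

_≋_ : ∀ {n} → Vec₄ n → Vec₄ n → Set
x ≋ y = ∀ j → x j ≡ y j

_≤lex_ : ∀ {m} → Vec₄ m → Vec₄ m → Set
_≤lex_ {m} a b =
  a ≋ b ⊎ Σ (Fin m) (λ k → (∀ (j : Fin m) → j F.< k → a j ≡ b j) × (a k <₄ b k))

InProw : ∀ {m n} → Mat₄ m n → Set
InProw {m} M = ∀ (i j : Fin m) → i F.≤ j → M i ≤lex M j

_·M_ : ∀ {m n} → Vec₄ m → Mat₄ m n → Vec₄ n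
(x ·M M) j = sum₄ (λ i → x i ⊗ M i j)

InCode : ∀ {m n} → Mat₄ m n → Vec₄ n → Set
InCode {m} G x = Σ (Vec₄ m) (λ c → x ≋ (c ·M G))

IsUnitSign : ℤ₄ → Set
IsUnitSign x = x ≡ z1 ⊎ x ≡ z3

IsSignedMonomial : ∀ {n} → Mat₄ n n → Set
IsSignedMonomial {n} P =
  (∀ i → Σ (Fin n) (λ j → IsUnitSign (P i j) × (∀ j' → j' ≢ j → P i j' ≡ z0)))
  × (∀ j → Σ (Fin n) (λ i → IsUnitSign (P i j) × (∀ i' → i' ≢ i → P i' j ≡ z0)))

-- codes C, C' (given as membership predicates) are equivalent:
-- C' = C P for some signed monomial matrix P
EquivCodes : ∀ {n} → (Vec₄ n → Set) → (Vec₄ n → Set) → Set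
EquivCodes {n} C C' = Σ (Mat₄ n n) λ P → IsSignedMonomial P ×
  ((∀ y → C' y → Σ (Vec₄ n) (λ x → C x × y ≋ (x ·M P))) ×
   (∀ x → C x → C' (x ·M P)))

-- G(A,B,D) = ( I_{k1}  A      B  )
--            ( O      2I_{k2}  2D )
-- of size (k1+k2) × (k1+k2+ℓ)

δ : ∀ {k} → Fin k → Fin k → ℤ₄
δ zero zero = z1
δ zero (suc j) = z0
δ (suc i) zero = z0
δ (suc i) (suc j) = δ i j

GMat : ∀ {k₁ k₂ ℓ} → (Fin k₁ → Fin k₂ → Bool) → Mat₄ k₁ ℓ →
       (Fin k₂ → Fin ℓ → Bool) → Mat₄ (k₁ + k₂) (k₁ + k₂ + ℓ)
GMat {k₁} {k₂} {ℓ} A B D i j with splitAt k₁ i | splitAt (k₁ + k₂) j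
... | inj₁ r | inj₁ c with splitAt k₁ c
...   | inj₁ c₁ = δ r c₁
...   | inj₂ c₂ = bit (A r c₂)
GMat A B D i j | inj₁ r | inj₂ c = B r c
GMat {k₁} A B D i j | inj₂ r | inj₁ c with splitAt k₁ c
...   | inj₁ c₁ = z0
...   | inj₂ c₂ = z2 ⊗ δ r c₂
GMat A B D i j | inj₂ r | inj₂ c = z2 ⊗ bit (D r c)

bitMat : ∀ {m n} → (Fin m → Fin n → Bool) → Mat₄ m n
bitMat A i j = bit (A i j)

module Submission where

-- Let π sort the rows of A.  Permuting the first k₁ rows of G(A,B,D) by π
-- and its first k₁ columns by the same π yields G(Aπ,Bπ,D): the identity
-- block is restored and only the rows of A and B move.  Permuting rows keeps
-- the code; permuting columns is an equivalence, realised by a permutation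
-- matrix, which is signed monomial.

open import Defs
open import Data.Nat using (ℕ; _+_)
open import Data.Fin using (Fin)
open import Data.Bool using (Bool)
open import Data.Product using (Σ; _×_)

open import Data.Nat as ℕ using (zero; suc; z≤n; s≤s; _^_; _≡ᵇ_)
import Data.Nat.Properties as ℕₚ
open import Data.Fin as F using (splitAt; join)
import Data.Fin.Properties as Fₚ
open import Data.Fin.Permutation as Perm using (Permutation′; _⟨$⟩ʳ_; _⟨$⟩ˡ_; inverseˡ; inverseʳ)
open import Data.Bool using (true; false; T; _∧_)
open import Data.Bool.Properties using (T-∧)
open import Data.Sum using (_⊎_; inj₁; inj₂; map₁)
open import Data.Product using (_,_; proj₁; proj₂)
open import Data.Unit using (tt)
open import Data.Empty using (⊥-elim)
open import Function using (_∘_; Equivalence)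
open import Relation.Nullary using (yes; no)
open import Relation.Binary.PropositionalEquality
open import Algebra.Bundles using (CommutativeMonoid)
import Algebra.Properties.CommutativeMonoid.Sum as CommutativeMonoidSum

_==₄_ : ℤ₄ → ℤ₄ → Bool
x ==₄ y = toℕ₄ x ≡ᵇ toℕ₄ y

fromℕ₄ : ℕ → ℤ₄
fromℕ₄ 0 = z0
fromℕ₄ 1 = z1
fromℕ₄ 2 = z2
fromℕ₄ _ = z3

fromℕ₄-toℕ₄ : ∀ x → fromℕ₄ (toℕ₄ x) ≡ x
fromℕ₄-toℕ₄ z0 = refl
fromℕ₄-toℕ₄ z1 = refl
fromℕ₄-toℕ₄ z2 = refl
fromℕ₄-toℕ₄ z3 = refl

==₄-sound : ∀ {x y} → T (x ==₄ y) → x ≡ y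
==₄-sound {x} {y} h = begin
  x                   ≡⟨ fromℕ₄-toℕ₄ x ⟨
  fromℕ₄ (toℕ₄ x)     ≡⟨ cong fromℕ₄ (ℕₚ.≡ᵇ⇒≡ (toℕ₄ x) (toℕ₄ y) h) ⟩
  fromℕ₄ (toℕ₄ y)     ≡⟨ fromℕ₄-toℕ₄ y ⟩
  y                   ∎
  where open ≡-Reasoning

-- A Boolean property of ℤ₄ holds everywhere if it holds at the four
-- elements; this decides the identities below by evaluation.
every₄ : (ℤ₄ → Bool) → Bool
every₄ p = p z0 ∧ p z1 ∧ p z2 ∧ p z3

every₄-sound : ∀ p → T (every₄ p) → ∀ x → T (p x)
every₄-sound p h = at
  where
  open Equivalence
  h₀ : T (p z0) × T (p z1 ∧ p z2 ∧ p z3)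
  h₀ = to (T-∧ {p z0}) h
  h₁ : T (p z1) × T (p z2 ∧ p z3)
  h₁ = to (T-∧ {p z1}) (proj₂ h₀)
  h₂ : T (p z2) × T (p z3)
  h₂ = to (T-∧ {p z2}) (proj₂ h₁)
  at : ∀ x → T (p x)
  at z0 = proj₁ h₀
  at z1 = proj₁ h₁
  at z2 = proj₁ h₂
  at z3 = proj₂ h₂

⊕-assoc : ∀ x y z → (x ⊕ y) ⊕ z ≡ x ⊕ (y ⊕ z)
⊕-assoc x y z = ==₄-sound (every₄-sound (pₓᵧ x y) (every₄-sound (pₓ x) (every₄-sound (every₄ ∘ pₓ) tt x) y) z)
  where
  pₓᵧ : ℤ₄ → ℤ₄ → ℤ₄ → Bool
  pₓᵧ x y z = ((x ⊕ y) ⊕ z) ==₄ (x ⊕ (y ⊕ z))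
  pₓ : ℤ₄ → ℤ₄ → Bool
  pₓ x y = every₄ (pₓᵧ x y)

⊕-comm : ∀ x y → x ⊕ y ≡ y ⊕ x
⊕-comm x y = ==₄-sound (every₄-sound (pₓ x) (every₄-sound (every₄ ∘ pₓ) tt x) y)
  where
  pₓ : ℤ₄ → ℤ₄ → Bool
  pₓ x y = (x ⊕ y) ==₄ (y ⊕ x)

⊕-identityʳ : ∀ x → x ⊕ z0 ≡ x
⊕-identityʳ x = ==₄-sound (every₄-sound (λ x → (x ⊕ z0) ==₄ x) tt x)

⊗-identityʳ : ∀ x → x ⊗ z1 ≡ x
⊗-identityʳ x = ==₄-sound (every₄-sound (λ x → (x ⊗ z1) ==₄ x) tt x)

⊗-zeroʳ : ∀ x → x ⊗ z0 ≡ z0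
⊗-zeroʳ x = ==₄-sound (every₄-sound (λ x → (x ⊗ z0) ==₄ z0) tt x)

⊕-commutativeMonoid : CommutativeMonoid _ _
⊕-commutativeMonoid = record
  { Carrier = ℤ₄ ; _≈_ = _≡_ ; _∙_ = _⊕_ ; ε = z0
  ; isCommutativeMonoid = record
    { isMonoid = record
      { isSemigroup = record
        { isMagma = record { isEquivalence = isEquivalence ; ∙-cong = cong₂ _⊕_ }
        ; assoc = ⊕-assoc }
      ; identity = (λ _ → refl) , ⊕-identityʳ }
    ; comm = ⊕-comm } }

module Σ₄ = CommutativeMonoidSum ⊕-commutativeMonoid

sum₄≡sum : ∀ {n} (f : Fin n → ℤ₄) → sum₄ f ≡ Σ₄.sum f
sum₄≡sum {zero}  f = refl
sum₄≡sum {suc n} f = cong (f F.zero ⊕_) (sum₄≡sum (f ∘ F.suc))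

sum₄-cong : ∀ {n} {f g : Fin n → ℤ₄} → (∀ i → f i ≡ g i) → sum₄ f ≡ sum₄ g
sum₄-cong {f = f} {g} f≗g =
  trans (sum₄≡sum f) (trans (Σ₄.sum-cong-≗ f≗g) (sym (sum₄≡sum g)))

sum₄-zero : ∀ {n} (f : Fin n → ℤ₄) → (∀ i → f i ≡ z0) → sum₄ f ≡ z0
sum₄-zero {n} f f≗0 =
  trans (sum₄≡sum f) (trans (Σ₄.sum-cong-≗ f≗0) (Σ₄.sum-replicate-zero n))

sum₄-permute : ∀ {n} (π : Permutation′ n) (f : Fin n → ℤ₄) →
               sum₄ f ≡ sum₄ (f ∘ (π ⟨$⟩ʳ_))
sum₄-permute π f =
  trans (sum₄≡sum f) (trans (Σ₄.sum-permute f π) (sym (sum₄≡sum (f ∘ (π ⟨$⟩ʳ_)))))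

δ-refl : ∀ {k} (i : Fin k) → δ i i ≡ z1
δ-refl F.zero    = refl
δ-refl (F.suc i) = δ-refl i

δ-≢ : ∀ {k} (i j : Fin k) → i ≢ j → δ i j ≡ z0
δ-≢ F.zero    F.zero    i≢j = ⊥-elim (i≢j refl)
δ-≢ F.zero    (F.suc j) i≢j = refl
δ-≢ (F.suc i) F.zero    i≢j = refl
δ-≢ (F.suc i) (F.suc j) i≢j = δ-≢ i j (i≢j ∘ cong F.suc)

-- δ only sees whether its arguments are equal, so injections preserve it.
δ-injective : ∀ {k} (f : Fin k → Fin k) → (∀ {a b} → f a ≡ f b → a ≡ b) →
              ∀ i j → δ (f i) (f j) ≡ δ i j
δ-injective f f-inj i j with i Fₚ.≟ j
... | yes refl = trans (δ-refl (f i)) (sym (δ-refl i))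
... | no  i≢j  = trans (δ-≢ _ _ (i≢j ∘ f-inj)) (sym (δ-≢ _ _ i≢j))

δ-select : ∀ {n} (x : Vec₄ n) j → sum₄ (λ i → x i ⊗ δ i j) ≡ x j
δ-select {suc n} x F.zero = begin
  x F.zero ⊗ z1 ⊕ sum₄ (λ i → x (F.suc i) ⊗ z0)  ≡⟨ cong₂ _⊕_ (⊗-identityʳ _) (sum₄-zero _ (⊗-zeroʳ ∘ x ∘ F.suc)) ⟩
  x F.zero ⊕ z0                                  ≡⟨ ⊕-identityʳ _ ⟩
  x F.zero                                       ∎
  where open ≡-Reasoning
δ-select {suc n} x (F.suc j) =
  trans (cong (_⊕ sum₄ (λ i → x (F.suc i) ⊗ δ i j)) (⊗-zeroʳ (x F.zero)))
        (δ-select (x ∘ F.suc) j)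

⟨$⟩ʳ-injective : ∀ {n} (π : Permutation′ n) {a b} → π ⟨$⟩ʳ a ≡ π ⟨$⟩ʳ b → a ≡ b
⟨$⟩ʳ-injective π {a} {b} e =
  trans (sym (inverseˡ π)) (trans (cong (π ⟨$⟩ˡ_) e) (inverseˡ π))

liftˡ : ∀ {a} → Permutation′ a → ∀ b → Permutation′ (a + b)
liftˡ {a} π b = Perm.permutation (act π) (act (Perm.flip π))
  (act-cancel π (Perm.flip π) (λ _ → inverseʳ π))
  (act-cancel (Perm.flip π) π (λ _ → inverseˡ π))
  where
  act : Permutation′ a → Fin (a + b) → Fin (a + b)
  act σ = join a b ∘ map₁ (σ ⟨$⟩ʳ_) ∘ splitAt a

  map₁-cancel : ∀ (σ τ : Permutation′ a) → (∀ i → σ ⟨$⟩ʳ (τ ⟨$⟩ʳ i) ≡ i) →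
                (s : Fin a ⊎ Fin b) → map₁ (σ ⟨$⟩ʳ_) (map₁ (τ ⟨$⟩ʳ_) s) ≡ s
  map₁-cancel σ τ στ (inj₁ i) = cong inj₁ (στ i)
  map₁-cancel σ τ στ (inj₂ i) = refl

  act-cancel : ∀ σ τ → (∀ i → σ ⟨$⟩ʳ (τ ⟨$⟩ʳ i) ≡ i) → ∀ i → act σ (act τ i) ≡ i
  act-cancel σ τ στ i = begin
    join a b (map₁ (σ ⟨$⟩ʳ_) (splitAt a (join a b (map₁ (τ ⟨$⟩ʳ_) (splitAt a i)))))
      ≡⟨ cong (join a b ∘ map₁ (σ ⟨$⟩ʳ_)) (Fₚ.splitAt-join a b (map₁ (τ ⟨$⟩ʳ_) (splitAt a i))) ⟩
    join a b (map₁ (σ ⟨$⟩ʳ_) (map₁ (τ ⟨$⟩ʳ_) (splitAt a i)))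
      ≡⟨ cong (join a b) (map₁-cancel σ τ στ (splitAt a i)) ⟩
    join a b (splitAt a i)
      ≡⟨ Fₚ.join-splitAt a b i ⟩
    i ∎
    where open ≡-Reasoning

splitAt-liftˡ : ∀ {a} (π : Permutation′ a) b i →
                splitAt a (liftˡ π b ⟨$⟩ʳ i) ≡ map₁ (π ⟨$⟩ʳ_) (splitAt a i)
splitAt-liftˡ {a} π b i = Fₚ.splitAt-join a b _

permMat : ∀ {n} → Permutation′ n → Mat₄ n n
permMat σ i j = δ i (σ ⟨$⟩ʳ j)

·permMat : ∀ {n} (σ : Permutation′ n) (x : Vec₄ n) j → (x ·M permMat σ) j ≡ x (σ ⟨$⟩ʳ j)
·permMat σ x j = δ-select x (σ ⟨$⟩ʳ j)

permMat-signedMonomial : ∀ {n} (σ : Permutation′ n) → IsSignedMonomial (permMat σ)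
permMat-signedMonomial {n} σ = row , column
  where
  row : ∀ i → Σ (Fin n) λ j → IsUnitSign (permMat σ i j) × (∀ j' → j' ≢ j → permMat σ i j' ≡ z0)
  row i = (σ ⟨$⟩ˡ i)
        , inj₁ (trans (cong (δ i) (inverseʳ σ)) (δ-refl i))
        , λ j j≢σ⁻¹i → δ-≢ i _ λ i≡σj → j≢σ⁻¹i (trans (sym (inverseˡ σ)) (cong (σ ⟨$⟩ˡ_) (sym i≡σj)))
  column : ∀ j → Σ (Fin n) λ i → IsUnitSign (permMat σ i j) × (∀ i' → i' ≢ i → permMat σ i' j ≡ z0)
  column j = (σ ⟨$⟩ʳ j) , inj₁ (δ-refl (σ ⟨$⟩ʳ j)) , λ i i≢σj → δ-≢ i _ i≢σj

-- If G' arises from G by permuting rows (ρ) and columns (σ), the codes are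
-- equivalent via the permutation matrix of σ: rows generate the same span
-- in any order, and permMat σ carries the columns of G to those of G'.
equivCodes-permute : ∀ {m n} (G G' : Mat₄ m n) (ρ : Permutation′ m) (σ : Permutation′ n) →
  (∀ i j → G' i j ≡ G (ρ ⟨$⟩ʳ i) (σ ⟨$⟩ʳ j)) →
  EquivCodes (InCode G) (InCode G')
equivCodes-permute {m} {n} G G' ρ σ G'≡ = permMat σ , permMat-signedMonomial σ , backward , forward
  where
  open ≡-Reasoning

  forward : ∀ x → InCode G x → InCode G' (x ·M permMat σ)
  forward x (c , x≋cG) = c ∘ (ρ ⟨$⟩ʳ_) , λ j → begin
    (x ·M permMat σ) j                                       ≡⟨ ·permMat σ x j ⟩
    x (σ ⟨$⟩ʳ j)                                             ≡⟨ x≋cG (σ ⟨$⟩ʳ j) ⟩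
    sum₄ (λ i → c i ⊗ G i (σ ⟨$⟩ʳ j))                       ≡⟨ sum₄-permute ρ _ ⟩
    sum₄ (λ i → c (ρ ⟨$⟩ʳ i) ⊗ G (ρ ⟨$⟩ʳ i) (σ ⟨$⟩ʳ j))     ≡⟨ sum₄-cong (λ i → cong (c (ρ ⟨$⟩ʳ i) ⊗_) (sym (G'≡ i j))) ⟩
    sum₄ (λ i → c (ρ ⟨$⟩ʳ i) ⊗ G' i j)                      ∎

  backward : ∀ y → InCode G' y → Σ (Vec₄ n) (λ x → InCode G x × y ≋ (x ·M permMat σ))
  backward y (c , y≋cG') = x , (c ∘ (ρ ⟨$⟩ˡ_) , x∈G) , y≋xP
    where
    x : Vec₄ n
    x = y ∘ (σ ⟨$⟩ˡ_)

    x∈G : x ≋ ((c ∘ (ρ ⟨$⟩ˡ_)) ·M G)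
    x∈G j = begin
      y (σ ⟨$⟩ˡ j)                                            ≡⟨ y≋cG' (σ ⟨$⟩ˡ j) ⟩
      sum₄ (λ i → c i ⊗ G' i (σ ⟨$⟩ˡ j))                     ≡⟨ sum₄-cong (λ i → cong (c i ⊗_) (trans (G'≡ i _) (cong (G (ρ ⟨$⟩ʳ i)) (inverseʳ σ)))) ⟩
      sum₄ (λ i → c i ⊗ G (ρ ⟨$⟩ʳ i) j)                      ≡⟨ sum₄-cong (λ i → cong (λ k → c k ⊗ G (ρ ⟨$⟩ʳ i) j) (inverseˡ ρ)) ⟨
      sum₄ (λ i → c (ρ ⟨$⟩ˡ (ρ ⟨$⟩ʳ i)) ⊗ G (ρ ⟨$⟩ʳ i) j)    ≡⟨ sum₄-permute ρ _ ⟨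
      sum₄ (λ i → c (ρ ⟨$⟩ˡ i) ⊗ G i j)                      ∎

    y≋xP : y ≋ (x ·M permMat σ)
    y≋xP j = trans (cong y (sym (inverseˡ σ))) (sym (·permMat σ x j))

GBlock : ∀ {k₁ k₂ ℓ} → (Fin k₁ → Fin k₂ → Bool) → Mat₄ k₁ ℓ → (Fin k₂ → Fin ℓ → Bool) →
         Fin k₁ ⊎ Fin k₂ → (Fin k₁ ⊎ Fin k₂) ⊎ Fin ℓ → ℤ₄
GBlock A B D (inj₁ r) (inj₁ (inj₁ c)) = δ r c
GBlock A B D (inj₁ r) (inj₁ (inj₂ c)) = bit (A r c)
GBlock A B D (inj₁ r) (inj₂ c)        = B r c
GBlock A B D (inj₂ r) (inj₁ (inj₁ c)) = z0
GBlock A B D (inj₂ r) (inj₁ (inj₂ c)) = z2 ⊗ δ r c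
GBlock A B D (inj₂ r) (inj₂ c)        = z2 ⊗ bit (D r c)

columnBlock : ∀ k₁ k₂ ℓ → Fin (k₁ + k₂ + ℓ) → (Fin k₁ ⊎ Fin k₂) ⊎ Fin ℓ
columnBlock k₁ k₂ ℓ = map₁ (splitAt k₁) ∘ splitAt (k₁ + k₂)

GMat-block : ∀ {k₁ k₂ ℓ} A B D i j →
  GMat {k₁} {k₂} {ℓ} A B D i j ≡ GBlock A B D (splitAt k₁ i) (columnBlock k₁ k₂ ℓ j)
GMat-block {k₁} {k₂} A B D i j with splitAt k₁ i | splitAt (k₁ + k₂) j
... | inj₁ r | inj₁ c with splitAt k₁ c
...   | inj₁ _ = refl
...   | inj₂ _ = refl
GMat-block A B D i j | inj₁ r | inj₂ c = refl
GMat-block {k₁} A B D i j | inj₂ r | inj₁ c with splitAt k₁ c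
...   | inj₁ _ = refl
...   | inj₂ _ = refl
GMat-block A B D i j | inj₂ r | inj₂ c = refl

module RowPermutation {k₁ k₂ ℓ : ℕ} (π : Permutation′ k₁)
  (A : Fin k₁ → Fin k₂ → Bool) (B : Mat₄ k₁ ℓ) (D : Fin k₂ → Fin ℓ → Bool) where

  rowPerm : Permutation′ (k₁ + k₂)
  rowPerm = liftˡ π k₂

  columnPerm : Permutation′ (k₁ + k₂ + ℓ)
  columnPerm = liftˡ rowPerm ℓ

  columnBlock-columnPerm : ∀ j →
    columnBlock k₁ k₂ ℓ (columnPerm ⟨$⟩ʳ j) ≡ map₁ (map₁ (π ⟨$⟩ʳ_)) (columnBlock k₁ k₂ ℓ j)
  columnBlock-columnPerm j
    rewrite splitAt-liftˡ rowPerm ℓ j with splitAt (k₁ + k₂) j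
  ... | inj₁ c = cong inj₁ (splitAt-liftˡ π k₂ c)
  ... | inj₂ c = refl

  GBlock-permute : ∀ r c →
    GBlock (A ∘ (π ⟨$⟩ʳ_)) (B ∘ (π ⟨$⟩ʳ_)) D r c ≡ GBlock A B D (map₁ (π ⟨$⟩ʳ_) r) (map₁ (map₁ (π ⟨$⟩ʳ_)) c)
  GBlock-permute (inj₁ r) (inj₁ (inj₁ c)) = sym (δ-injective _ (⟨$⟩ʳ-injective π) r c)
  GBlock-permute (inj₁ r) (inj₁ (inj₂ c)) = refl
  GBlock-permute (inj₁ r) (inj₂ c)        = refl
  GBlock-permute (inj₂ r) (inj₁ (inj₁ c)) = refl
  GBlock-permute (inj₂ r) (inj₁ (inj₂ c)) = refl
  GBlock-permute (inj₂ r) (inj₂ c)        = refl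

  GMat-permute : ∀ i j →
    GMat (A ∘ (π ⟨$⟩ʳ_)) (B ∘ (π ⟨$⟩ʳ_)) D i j ≡ GMat A B D (rowPerm ⟨$⟩ʳ i) (columnPerm ⟨$⟩ʳ j)
  GMat-permute i j = begin
    GMat (A ∘ (π ⟨$⟩ʳ_)) (B ∘ (π ⟨$⟩ʳ_)) D i j
      ≡⟨ GMat-block _ _ D i j ⟩
    GBlock (A ∘ (π ⟨$⟩ʳ_)) (B ∘ (π ⟨$⟩ʳ_)) D (splitAt k₁ i) (columnBlock k₁ k₂ ℓ j)
      ≡⟨ GBlock-permute (splitAt k₁ i) (columnBlock k₁ k₂ ℓ j) ⟩
    GBlock A B D (map₁ (π ⟨$⟩ʳ_) (splitAt k₁ i)) (map₁ (map₁ (π ⟨$⟩ʳ_)) (columnBlock k₁ k₂ ℓ j))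
      ≡⟨ cong₂ (GBlock A B D) (splitAt-liftˡ π k₂ i) (columnBlock-columnPerm j) ⟨
    GBlock A B D (splitAt k₁ (rowPerm ⟨$⟩ʳ i)) (columnBlock k₁ k₂ ℓ (columnPerm ⟨$⟩ʳ j))
      ≡⟨ GMat-block A B D _ _ ⟨
    GMat A B D (rowPerm ⟨$⟩ʳ i) (columnPerm ⟨$⟩ʳ j) ∎
    where open ≡-Reasoning

-- The binary value of a bit vector, most significant bit first.
binary : ∀ {k} → (Fin k → Bool) → ℕ
binary {zero}  a = 0
binary {suc k} a = digit (a F.zero) + binary (a ∘ F.suc)
  where
  digit : Bool → ℕ
  digit true  = 2 ^ k
  digit false = 0

-- A row starting with 1 outweighs every row starting with 0.
binary<2^k : ∀ {k} (a : Fin k → Bool) → binary a ℕ.< 2 ^ k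
binary<2^k {zero}  a = s≤s z≤n
binary<2^k {suc k} a with a F.zero
... | true  = ℕₚ.+-monoʳ-< (2 ^ k) (ℕₚ.<-≤-trans (binary<2^k (a ∘ F.suc)) (ℕₚ.≤-reflexive (sym (ℕₚ.+-identityʳ (2 ^ k)))))
... | false = ℕₚ.<-≤-trans (binary<2^k (a ∘ F.suc)) (ℕₚ.m≤m+n (2 ^ k) _)

≤lex-cons : ∀ {k} {x y : Vec₄ (suc k)} → x F.zero ≡ y F.zero →
            (x ∘ F.suc) ≤lex (y ∘ F.suc) → x ≤lex y
≤lex-cons x₀≡y₀ (inj₁ x≋y) = inj₁ λ { F.zero → x₀≡y₀ ; (F.suc j) → x≋y j }
≤lex-cons x₀≡y₀ (inj₂ (k , agree , x<y)) =
  inj₂ (F.suc k , (λ { F.zero _ → x₀≡y₀ ; (F.suc j) (s≤s j<k) → agree j j<k }) , x<y)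

binary-≤⇒≤lex : ∀ {k} (a b : Fin k → Bool) → binary a ℕ.≤ binary b →
                (bit ∘ a) ≤lex (bit ∘ b)
binary-≤⇒≤lex {zero}  a b _ = inj₁ λ ()
binary-≤⇒≤lex {suc k} a b a≤b with a F.zero in a₀ | b F.zero in b₀
... | false | false = ≤lex-cons (cong bit (trans a₀ (sym b₀))) (binary-≤⇒≤lex _ _ a≤b)
... | true  | true  = ≤lex-cons (cong bit (trans a₀ (sym b₀)))
                        (binary-≤⇒≤lex _ _ (ℕₚ.+-cancelˡ-≤ (2 ^ k) _ _ a≤b))
... | false | true  = inj₂ (F.zero , (λ _ ()) ,
                        subst₂ (λ u v → bit u <₄ bit v) (sym a₀) (sym b₀) (s≤s z≤n))
... | true  | false = ⊥-elim (ℕₚ.<⇒≱ (binary<2^k (b ∘ F.suc))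
                        (ℕₚ.≤-trans (ℕₚ.m≤m+n (2 ^ k) _) a≤b))

argmin : ∀ {k} (f : Fin (suc k) → ℕ) → Σ (Fin (suc k)) λ m → ∀ i → f m ℕ.≤ f i
argmin {zero} f = F.zero , λ { F.zero → ℕₚ.≤-refl }
argmin {suc k} f with argmin (f ∘ F.suc)
... | m , m-min with f F.zero ℕₚ.≤? f (F.suc m)
...   | yes f₀≤ = F.zero  , λ { F.zero → ℕₚ.≤-refl ; (F.suc i) → ℕₚ.≤-trans f₀≤ (m-min i) }
...   | no  f₀≰ = F.suc m , λ { F.zero → ℕₚ.≰⇒≥ f₀≰ ; (F.suc i) → m-min i }

sortBy : ∀ {k} (f : Fin k → ℕ) →
         Σ (Permutation′ k) λ π → ∀ i j → i F.≤ j → f (π ⟨$⟩ʳ i) ℕ.≤ f (π ⟨$⟩ʳ j)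
sortBy {zero} f = Perm.id , λ ()
sortBy {suc k} f with argmin f
... | m , m-min with sortBy (f ∘ (Perm.transpose F.zero m ⟨$⟩ʳ_) ∘ F.suc)
...   | σ , σ-sorts = Perm.lift₀ σ Perm.∘ₚ Perm.transpose F.zero m , sorted
  where
  sorted : ∀ i j → i F.≤ j →
           f ((Perm.lift₀ σ Perm.∘ₚ Perm.transpose F.zero m) ⟨$⟩ʳ i) ℕ.≤
           f ((Perm.lift₀ σ Perm.∘ₚ Perm.transpose F.zero m) ⟨$⟩ʳ j)
  sorted F.zero    j         _         = m-min _
  sorted (F.suc i) (F.suc j) (s≤s i≤j) = σ-sorts i j i≤j

lemma5p1 : (k₁ k₂ ℓ : ℕ) →
    (A : Fin k₁ → Fin k₂ → Bool) (B : Mat₄ k₁ ℓ) (D : Fin k₂ → Fin ℓ → Bool) →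
    Σ (Fin k₁ → Fin k₂ → Bool) λ A' → Σ (Mat₄ k₁ ℓ) λ B' → Σ (Fin k₂ → Fin ℓ → Bool) λ D' →
    InProw (bitMat A') ×
    EquivCodes (InCode (GMat A B D)) (InCode (GMat A' B' D'))
lemma5p1 k₁ k₂ ℓ A B D =
  A ∘ (π ⟨$⟩ʳ_) , B ∘ (π ⟨$⟩ʳ_) , D ,
  (λ i j i≤j → binary-≤⇒≤lex _ _ (π-sorts i j i≤j)) ,
  equivCodes-permute _ _ rowPerm columnPerm GMat-permute
  where
  sorting : Σ (Permutation′ k₁) λ π → ∀ i j → i F.≤ j →
            binary (A (π ⟨$⟩ʳ i)) ℕ.≤ binary (A (π ⟨$⟩ʳ j))
  sorting = sortBy (binary ∘ A)
  π : Permutation′ k₁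
  π = proj₁ sorting
  π-sorts : ∀ i j → i F.≤ j → binary (A (π ⟨$⟩ʳ i)) ℕ.≤ binary (A (π ⟨$⟩ʳ j))
  π-sorts = proj₂ sorting
  open RowPermutation π A B D
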